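{- Let $x$ be a non-ultimately periodic infinite word and $u$ a factor of $x$. Any consecutive decomposition of $u$ with $L(u)$ terms is irreducible.
   Context: Write $x=x_0x_1\ldots$. For a factor $u$ of $x$, $A(u)=\min\{k: u=x_k\cdots x_{k+|u|-1}\}$ and $B(u)=A(u)+|u|$. A decomposition $u=v_1v_2\cdots v_l$ ($l\geq1$, $v_i$ nonempty) is consecutive if $A(v_1)=A(u)$, $B(v_l)=B(u)$ and $B(v_i)=A(v_{i+1})$ for $i=1,\ldots,l-1$. The consecutive length $L(u)$ is the maximal number of terms of a consecutive decomposition of $u$. A factor $v$ is irreducible if $L(v)=1$; a consecutive decomposition is irreducible if all its terms are irreducible. -}

module Defs where

open import Data.Nat using (ℕ; zero; suc; _+_; _≤_; _<_)
open import Data.List using (List; []; _∷_; length; map; upTo; concat)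
open import Data.List.Relation.Unary.All using (All)
open import Data.Product using (Σ; ∃; _×_; _,_)
open import Relation.Binary.PropositionalEquality using (_≡_)
open import Relation.Nullary using (¬_)

Word : Set → Set
Word A = ℕ → A

factorAt : {A : Set} → Word A → ℕ → ℕ → List A
factorAt x k n = map (λ i → x (k + i)) (upTo n)

OccursAt : {A : Set} → Word A → List A → ℕ → Set
OccursAt x u k = u ≡ factorAt x k (length u)

Factor : {A : Set} → Word A → List A → Set
Factor x u = ∃ λ k → OccursAt x u k

IsA : {A : Set} → Word A → List A → ℕ → Set
IsA x u k = OccursAt x u k × (∀ j → OccursAt x u j → k ≤ j)

UltimatelyPeriodic : {A : Set} → Word A → Set
UltimatelyPeriodic x =
  Σ ℕ λ p → 0 < p × Σ ℕ λ N → ∀ n → N ≤ n → x (n + p) ≡ x n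

NonEmptyWord : {A : Set} → List A → Set
NonEmptyWord u = 0 < length u

-- Chain v_1 ... v_l starting at position a and ending at position b:
-- A(v_1) = a, B(v_i) = A(v_{i+1}), B(v_l) = b, where B(v) = A(v) + |v|.
Chain : {A : Set} → Word A → ℕ → List (List A) → ℕ → Set
Chain x a []       b = a ≡ b
Chain x a (v ∷ vs) b = IsA x v a × Chain x (a + length v) vs b

ConsecutiveDecomp : {A : Set} → Word A → List A → List (List A) → Set
ConsecutiveDecomp x u vs =
  0 < length vs × All NonEmptyWord vs × concat vs ≡ u ×
  Σ ℕ λ a → IsA x u a × Chain x a vs (a + length u)

HasConsecLength : {A : Set} → Word A → List A → ℕ → Set
HasConsecLength {A} x u n =
  (Σ (List (List A)) λ vs → ConsecutiveDecomp x u vs × length vs ≡ n) ×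
  (∀ vs → ConsecutiveDecomp x u vs → length vs ≤ n)

Irreducible : {A : Set} → Word A → List A → Set
Irreducible x v = HasConsecLength x v 1

-- If some term v of a consecutive decomposition of u with L(u) terms had a
-- consecutive decomposition into two or more terms, substituting it for v
-- would give a consecutive decomposition of u with more than L(u) terms: the
-- chain conditions glue because A(v) is determined by v.
module Submission where

open import Defs
open import Data.Nat using (ℕ; _+_; _≤_; z≤n; s≤s)
open import Data.Nat.Properties using (≤-antisym; ≤-trans; +-cancelˡ-≤; +-cancelʳ-≤)
open import Data.List using (List; []; _∷_; [_]; length; _++_; concat)
open import Data.List.Properties using (length-++; length-++-≤ˡ; length-++-≤ʳ; concat-++; ++-identityʳ)
open import Data.List.Membership.Propositional using (_∈_)
open import Data.List.Membership.Propositional.Properties using (∈-∃++)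
open import Data.List.Relation.Unary.All as All using (All; _∷_)
open import Data.List.Relation.Unary.All.Properties using (++⁺; ++⁻ˡ; ++⁻ʳ)
open import Data.Product using (∃; _×_; _,_)
open import Relation.Binary.PropositionalEquality using (_≡_; refl; sym; trans; cong; subst; subst₂; module ≡-Reasoning)
open import Relation.Nullary using (¬_)

length-infix-cancel-≤ : ∀ {B : Set} (pre : List B) {ws ys : List B} post →
  length (pre ++ ws ++ post) ≤ length (pre ++ ys ++ post) → length ws ≤ length ys
length-infix-cancel-≤ pre {ws} {ys} post le =
  +-cancelʳ-≤ (length post) _ _ (+-cancelˡ-≤ (length pre) _ _ (subst₂ _≤_ (length-infix ws) (length-infix ys) le))
  where
  length-infix : ∀ zs → length (pre ++ zs ++ post) ≡ length pre + (length zs + length post)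
  length-infix zs = trans (length-++ pre) (cong (length pre +_) (length-++ zs))

module _ {A : Set} (x : Word A) where

  IsA-unique : ∀ {v a b} → IsA x v a → IsA x v b → a ≡ b
  IsA-unique (occ-a , least-a) (occ-b , least-b) = ≤-antisym (least-a _ occ-b) (least-b _ occ-a)

  Chain-++⁺ : ∀ {a b c} ps {qs} → Chain x a ps b → Chain x b qs c → Chain x a (ps ++ qs) c
  Chain-++⁺ []       refl          ch′ = ch′
  Chain-++⁺ (p ∷ ps) (isA-p , ch) ch′ = isA-p , Chain-++⁺ ps ch ch′

  Chain-++⁻ : ∀ {a c} ps {qs} → Chain x a (ps ++ qs) c → ∃ λ b → Chain x a ps b × Chain x b qs c
  Chain-++⁻ {a} []  ch = a , refl , ch
  Chain-++⁻ (p ∷ ps) (isA-p , ch) with b , ch-ps , ch-qs ← Chain-++⁻ ps ch = b , (isA-p , ch-ps) , ch-qs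

  ConsecutiveDecomp-term : ∀ {u} pre {v} post → ConsecutiveDecomp x u (pre ++ v ∷ post) →
    ConsecutiveDecomp x v [ v ]
  ConsecutiveDecomp-term pre {v} post (_ , nonempty , _ , _ , _ , ch)
    with c , _ , isA-v , _ ← Chain-++⁻ pre ch =
    s≤s z≤n , All.head (++⁻ʳ pre nonempty) ∷ All.[] , ++-identityʳ v , c , isA-v , isA-v , refl

  ConsecutiveDecomp-refine : ∀ {u} pre {v ws} post →
    ConsecutiveDecomp x u (pre ++ v ∷ post) → ConsecutiveDecomp x v ws →
    ConsecutiveDecomp x u (pre ++ ws ++ post)
  ConsecutiveDecomp-refine {u} pre {v} {ws} post (_ , nonempty , concat-u , a , isA-u , ch)
                                              (ws-terms , ws-nonempty , concat-v , c′ , isA-v′ , ch-ws)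
    with c , ch-pre , isA-v , ch-post ← Chain-++⁻ pre ch
    rewrite IsA-unique isA-v′ isA-v =
      ≤-trans ws-terms (≤-trans (length-++-≤ˡ ws) (length-++-≤ʳ (ws ++ post) {pre}))
    , ++⁺ (++⁻ˡ pre nonempty) (++⁺ ws-nonempty (All.tail (++⁻ʳ pre nonempty)))
    , concat-refined
    , a , isA-u , Chain-++⁺ pre ch-pre (Chain-++⁺ ws ch-ws ch-post)
    where
    open ≡-Reasoning
    concat-refined : concat (pre ++ ws ++ post) ≡ u
    concat-refined = begin
      concat (pre ++ ws ++ post)               ≡⟨ concat-++ pre (ws ++ post) ⟨
      concat pre ++ concat (ws ++ post)        ≡⟨ cong (concat pre ++_) (concat-++ ws post) ⟨
      concat pre ++ (concat ws ++ concat post) ≡⟨ cong (λ w → concat pre ++ (w ++ concat post)) concat-v ⟩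
      concat pre ++ (v ++ concat post)         ≡⟨ concat-++ pre (v ∷ post) ⟩
      concat (pre ++ v ∷ post)                 ≡⟨ concat-u ⟩
      u                                        ∎

  maximal-decomp-term-irreducible : ∀ {u n} pre {v} post → HasConsecLength x u n →
    ConsecutiveDecomp x u (pre ++ v ∷ post) → length (pre ++ v ∷ post) ≡ n → Irreducible x v
  maximal-decomp-term-irreducible pre {v} post (_ , maximal) decomp terms =
    ([ v ] , ConsecutiveDecomp-term pre post decomp , refl) , at-most-one-term
    where
    at-most-one-term : ∀ ws → ConsecutiveDecomp x v ws → length ws ≤ 1
    at-most-one-term ws decomp-v = length-infix-cancel-≤ pre post
      (subst (length (pre ++ ws ++ post) ≤_) (sym terms)
        (maximal _ (ConsecutiveDecomp-refine pre post decomp decomp-v)))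

  maximal-decomp-irreducible : ∀ {u n vs} → HasConsecLength x u n →
    ConsecutiveDecomp x u vs → length vs ≡ n → All (Irreducible x) vs
  maximal-decomp-irreducible {u} {n} {vs} hasL decomp terms = All.tabulate term-irreducible
    where
    term-irreducible : ∀ {v} → v ∈ vs → Irreducible x v
    term-irreducible v∈vs with pre , post , vs≡ ← ∈-∃++ v∈vs =
      maximal-decomp-term-irreducible pre post hasL
        (subst (ConsecutiveDecomp x u) vs≡ decomp) (subst (λ ws → length ws ≡ n) vs≡ terms)

proposition11 : {A : Set} (x : Word A) → ¬ UltimatelyPeriodic x →
    (u : List A) → Factor x u → (n : ℕ) → HasConsecLength x u n →
    (vs : List (List A)) → ConsecutiveDecomp x u vs → length vs ≡ n →
    All (Irreducible x) vs
proposition11 x _ u _ n hasL vs = maximal-decomp-irreducible x hasL
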